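{- Let $n\ge 6$ with $n\equiv 0$ or $n\equiv 1\pmod 4$, and let $\ell\in[n]$. Define the set $U_\ell$ by $$U_\ell=\{(1,\ell),\,(\ell,n),\,(n,n+1-\ell),\,(n+1-\ell,1)\}$$ if $n\equiv 0\pmod 4$, and by $$U_\ell=\{(1,\ell),\,(\ell,n),\,(n,n+1-\ell),\,(n+1-\ell,1)\}\cup\{(\tfrac{n+1}{2},\tfrac{n+1}{2})\}$$ if $n\equiv 1\pmod 4$. Let $D^{(\ell)}$ be the set of all sets $D\subseteq[n]\times[n]$ such that $D\cap U_\ell=\emptyset$, $D\cup U_\ell$ is an $n$-queens configuration, and $r(D\cup U_\ell)=D\cup U_\ell$. Then $|D^{(\ell)}|$ is even.
   Context: For a positive integer $N$ write $[N]=\{1,\dots,N\}$. An $n$-queens configuration is a set $Q\subseteq[n]\times[n]$ with $|Q|=n$ such that no two distinct elements of $Q$ share a row (same first coordinate), a column (same second coordinate), a diagonal (same value of $j-i$), or an anti-diagonal (same value of $i+j$). The rotation $r$ acts on subsets of $[n]\times[n]$ by $rQ=\{(n+1-j,i):(i,j)\in Q\}$. -}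

module Defs where

open import Data.Bool using (Bool; true; false; _∧_; _∨_)
open import Data.Nat using (ℕ; zero; suc; _+_; _∸_; _≡ᵇ_; _≤_; _%_; _/_)
open import Data.Fin using (Fin; toℕ; opposite)
open import Data.Fin.Subset using (Subset; ∣_∣; _∪_; inside)
open import Data.Vec using (Vec; lookup; tabulate; zipWith; map; sum)
open import Data.Product using (_×_; _,_; Σ)
open import Data.Sum using (_⊎_)
open import Data.List using (List; length)
open import Data.List.Relation.Unary.Unique.Propositional using (Unique)
import Data.List.Membership.Propositional as L
open import Data.Nat.Divisibility using (_∣_)
open import Relation.Binary.PropositionalEquality using (_≡_; _≢_)
open import Relation.Nullary using (¬_)
open import Function.Bundles using (_⇔_)

-- A subset of [n]×[n] is a board: B [i] [j] = inside iff (i+1, j+1) ∈ B,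
-- i.e. Fin index k stands for the coordinate k+1 ∈ [n].
Board : ℕ → Set
Board n = Vec (Subset n) n

_∈B_ : ∀ {n} → Fin n × Fin n → Board n → Set
(i , j) ∈B B = lookup (lookup B i) j ≡ inside

card : ∀ {n} → Board n → ℕ
card B = sum (map ∣_∣ B)

_∪B_ : ∀ {n} → Board n → Board n → Board n
A ∪B B = zipWith _∪_ A B

-- the rotation r(Q) = {(n+1-j, i) : (i,j) ∈ Q}; in 0-based Fin indices
-- (a, b) ∈ rQ iff (b, opposite a) ∈ Q, since n+1-(k+1) = (n-1-k)+1.
rot : ∀ {n} → Board n → Board n
rot B = tabulate λ a → tabulate λ b → lookup (lookup B b) (opposite a)

Attack : ∀ {n} → Fin n × Fin n → Fin n × Fin n → Set
Attack (i , j) (i' , j') =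
  (i ≡ i') ⊎ (j ≡ j') ⊎ (toℕ j + toℕ i' ≡ toℕ j' + toℕ i) ⊎ (toℕ i + toℕ j ≡ toℕ i' + toℕ j')

IsQueens : ∀ n → Board n → Set
IsQueens n Q = card Q ≡ n ×
  (∀ p q → p ∈B Q → q ∈B Q → p ≢ q → ¬ Attack p q)

inU : ℕ → ℕ → ℕ → ℕ → Bool
inU n ℓ a b =
  ((a ≡ᵇ 1) ∧ (b ≡ᵇ ℓ)) ∨
  ((a ≡ᵇ ℓ) ∧ (b ≡ᵇ n)) ∨
  ((a ≡ᵇ n) ∧ (b ≡ᵇ (suc n ∸ ℓ))) ∨
  ((a ≡ᵇ (suc n ∸ ℓ)) ∧ (b ≡ᵇ 1)) ∨
  ((n % 4 ≡ᵇ 1) ∧ (a ≡ᵇ ((n + 1) / 2)) ∧ (b ≡ᵇ ((n + 1) / 2)))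

U : ∀ n → ℕ → Board n
U n ℓ = tabulate λ i → tabulate λ j → inU n ℓ (suc (toℕ i)) (suc (toℕ j))

InDℓ : ∀ n → ℕ → Board n → Set
InDℓ n ℓ D =
  (∀ p → ¬ (p ∈B D × p ∈B U n ℓ)) ×
  IsQueens n (D ∪B U n ℓ) ×
  rot (D ∪B U n ℓ) ≡ D ∪B U n ℓ

-- a predicate on boards describes a finite set whose cardinality is even:
-- it is enumerated by a duplicate-free list of even length
EvenCard : ∀ {n} → (Board n → Set) → Set
EvenCard {n} P = Σ (List (Board n)) λ xs →
  Unique xs × (∀ D → (D L.∈ xs) ⇔ P D) × (2 ∣ length xs)

{-# OPTIONS --safe #-}
-- Transposition D ↦ Dᵀ is a fixed-point-free involution on D^(ℓ). Since U_ℓ is invariant under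
-- the rotation r, the lines (rows, columns, diagonals, anti-diagonals) meeting U_ℓ form a
-- transposition-invariant family, so Dᵀ ∪ U_ℓ is again an r-symmetric n-queens configuration.
-- If D = Dᵀ, a queen at (a, b) and one at (b, a) would share an anti-diagonal, so D lies on the
-- main diagonal; being r-invariant, it then lies in the central row. But one of rows 2 and 3
-- misses U_ℓ (whose rows are 1, ℓ, n+1-ℓ, n and the centre), and for n ≥ 6 it is not the central
-- row, so it would contain no queen.
module Submission where

open import Data.Bool as Bool using (Bool; true; false; _∨_; _∧_; T)
open import Data.Bool.Properties using (∨-zeroʳ; ∧-comm)
open import Data.Empty using (⊥; ⊥-elim)
open import Data.Fin using (Fin; toℕ; opposite; fromℕ<; punchIn) renaming (zero to fzero; suc to fsuc)
import Data.Fin.Properties as Fin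
open import Data.Fin.Subset using (Subset; ∣_∣)
open import Data.List using (List; []; _∷_; length; cartesianProductWith; filter; deduplicate)
open import Data.List.Membership.Propositional using (_∈_; _∉_; _─_)
open import Data.List.Membership.Propositional.Properties
  using (∈-cartesianProductWith⁺; ∈-filter⁺; ∈-filter⁻; ∈-deduplicate⁺; ∈-deduplicate⁻)
open import Data.List.Properties using (length-removeAt′)
import Data.List.Relation.Unary.All as All
import Data.List.Relation.Unary.All.Properties as All
open import Data.List.Relation.Unary.AllPairs using ([]; _∷_)
open import Data.List.Relation.Unary.Any using (here; there; index)
open import Data.List.Relation.Unary.Unique.DecPropositional.Properties using (deduplicate-!)
open import Data.List.Relation.Unary.Unique.Propositional using (Unique)
open import Data.Nat using (ℕ; zero; suc; _+_; _*_; _∸_; _≤_; _<_; _%_; _/_; _≡ᵇ_; z≤n; s≤s)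
open import Data.Nat.Divisibility using (_∣_; _∣0; ∣-refl; ∣m∣n⇒∣m+n)
open import Data.Nat.DivMod using (m≡m%n+[m/n]*n; m*n/n≡m)
open import Data.Nat.Properties
open import Data.Nat.Tactic.RingSolver using (solve-∀)
open import Data.Product using (_×_; _,_; ∃; proj₁; proj₂; swap)
open import Data.Product.Properties using (≡-dec)
open import Data.Sum using (_⊎_; inj₁; inj₂)
open import Data.Vec as Vec using (Vec; []; _∷_; lookup; tabulate)
open import Data.Vec.Functional using (removeAt)
import Data.Vec.Properties as Vec
open import Function using (_∘_; case_of_)
open import Function.Bundles using (_⇔_; mk⇔; Equivalence)
open import Relation.Binary using (DecidableEquality)
open import Relation.Binary.PropositionalEquality
  using (_≡_; _≢_; refl; sym; trans; cong; cong₂; subst; module ≡-Reasoning)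
open import Relation.Nullary using (¬_; Dec; yes; no; ¬?; _×-dec_; _⊎-dec_; _→-dec_)
open import Relation.Nullary.Decidable using (decidable-stable; dec-false; does-⇔; map′)
open import Relation.Unary using (Decidable)

open import Defs

open import Algebra.Properties.CommutativeMonoid.Sum +-0-commutativeMonoid
  using (sum; sum-syntax; sum-cong-≗; sum-replicate-zero; sum-remove; ∑-distrib-+; ∑-comm)

Cell : ℕ → Set
Cell n = Fin n × Fin n

at : ∀ {n} → Board n → Fin n → Fin n → Bool
at B i j = lookup (lookup B i) j

vec-ext : ∀ {A : Set} {n} {u v : Vec A n} → (∀ i → lookup u i ≡ lookup v i) → u ≡ v
vec-ext {u = u} {v} u≗v =
  trans (sym (Vec.tabulate∘lookup u)) (trans (Vec.tabulate-cong u≗v) (Vec.tabulate∘lookup v))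

board-ext : ∀ {n} {A B : Board n} → (∀ i j → at A i j ≡ at B i j) → A ≡ B
board-ext A≗B = vec-ext λ i → vec-ext (A≗B i)

at-tabulate : ∀ {n} (F : Fin n → Fin n → Bool) i j → at (tabulate λ a → tabulate (F a)) i j ≡ F i j
at-tabulate F i j =
  trans (cong (λ row → lookup row j) (Vec.lookup∘tabulate _ i)) (Vec.lookup∘tabulate (F i) j)

at-∪ : ∀ {n} (A B : Board n) i j → at (A ∪B B) i j ≡ at A i j ∨ at B i j
at-∪ A B i j = trans (cong (λ row → lookup row j) (Vec.lookup-zipWith _ i A B))
  (Vec.lookup-zipWith _∨_ j (lookup A i) (lookup B i))

at-rot : ∀ {n} (B : Board n) i j → at (rot B) i j ≡ at B j (opposite i)
at-rot B = at-tabulate λ i j → at B j (opposite i)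

transpose : ∀ {n} → Board n → Board n
transpose B = tabulate λ i → tabulate λ j → at B j i

at-transpose : ∀ {n} (B : Board n) i j → at (transpose B) i j ≡ at B j i
at-transpose B = at-tabulate λ i j → at B j i

transpose-involutive : ∀ {n} (B : Board n) → transpose (transpose B) ≡ B
transpose-involutive B = board-ext λ i j → trans (at-transpose (transpose B) i j) (at-transpose B j i)

∈-transpose : ∀ {n} (B : Board n) {a b} → (a , b) ∈B transpose B → (b , a) ∈B B
∈-transpose B {a} {b} ab∈ = trans (sym (at-transpose B a b)) ab∈

∈-∪⁻ : ∀ {n} (A B : Board n) {p} → p ∈B (A ∪B B) → p ∈B A ⊎ p ∈B B
∈-∪⁻ A B {i , j} p∈ with at A i j | at B i j | trans (sym (at-∪ A B i j)) p∈
... | true  | _ | _ = inj₁ refl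
... | false | _ | p∈B = inj₂ p∈B

∈-∪⁺ˡ : ∀ {n} (A B : Board n) {p} → p ∈B A → p ∈B (A ∪B B)
∈-∪⁺ˡ A B {i , j} p∈A = trans (at-∪ A B i j) (cong (_∨ at B i j) p∈A)

∈-∪⁺ʳ : ∀ {n} (A B : Board n) {p} → p ∈B B → p ∈B (A ∪B B)
∈-∪⁺ʳ A B {i , j} p∈B = trans (at-∪ A B i j) (trans (cong (at A i j ∨_) p∈B) (∨-zeroʳ _))

Disjoint : ∀ {n} → Board n → Board n → Set
Disjoint A B = ∀ p → ¬ (p ∈B A × p ∈B B)

turn : ∀ {n} → Cell n → Cell n
turn (i , j) = (j , opposite i)

∈-turn : ∀ {n} {B : Board n} {p} → rot B ≡ B → p ∈B B → turn p ∈B B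
∈-turn {B = B} {i , j} B-rot p∈B = trans (sym (at-rot B i j)) (trans (cong (λ X → at X i j) B-rot) p∈B)

rot-∪ : ∀ {n} (A B : Board n) → rot (A ∪B B) ≡ rot A ∪B rot B
rot-∪ A B = board-ext λ i j → begin
  at (rot (A ∪B B)) i j               ≡⟨ at-rot (A ∪B B) i j ⟩
  at (A ∪B B) j (opposite i)          ≡⟨ at-∪ A B j (opposite i) ⟩
  at A j (opposite i) ∨ at B j (opposite i) ≡⟨ sym (cong₂ _∨_ (at-rot A i j) (at-rot B i j)) ⟩
  at (rot A) i j ∨ at (rot B) i j     ≡⟨ sym (at-∪ (rot A) (rot B) i j) ⟩
  at (rot A ∪B rot B) i j             ∎
  where open ≡-Reasoning

∪-cancelʳ : ∀ {n} {A B C : Board n} → Disjoint A C → Disjoint B C → A ∪B C ≡ B ∪B C → A ≡ B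
∪-cancelʳ {A = A} {B} {C} A#C B#C A∪C≡B∪C = board-ext λ i j →
  cancel (at A i j) (at B i j) (at C i j) (λ a c → A#C (i , j) (a , c)) (λ b c → B#C (i , j) (b , c))
    (trans (sym (at-∪ A C i j)) (trans (cong (λ X → at X i j) A∪C≡B∪C) (at-∪ B C i j)))
  where
  cancel : ∀ a b c → (a ≡ true → c ≡ true → ⊥) → (b ≡ true → c ≡ true → ⊥) → a ∨ c ≡ b ∨ c → a ≡ b
  cancel true  true  _     _  _  _ = refl
  cancel false false _     _  _  _ = refl
  cancel true  false true  ac _  _ = ⊥-elim (ac refl refl)
  cancel false true  true  _  bc _ = ⊥-elim (bc refl refl)
  cancel true  false false _  _  ()
  cancel false true  false _  _  ()

disjoint-rot : ∀ {n} (A : Board n) {C : Board n} → rot C ≡ C → Disjoint A C → Disjoint (rot A) C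
disjoint-rot A C-rot A#C (i , j) (ij∈rotA , ij∈C) =
  A#C (j , opposite i) (trans (sym (at-rot A i j)) ij∈rotA , ∈-turn C-rot ij∈C)

rot-transpose : ∀ {n} {B : Board n} → rot B ≡ B → rot (transpose B) ≡ transpose B
rot-transpose {B = B} B-rot = board-ext λ i j → begin
  at (rot (transpose B)) i j       ≡⟨ at-rot (transpose B) i j ⟩
  at (transpose B) j (opposite i)  ≡⟨ at-transpose B j (opposite i) ⟩
  at B (opposite i) j              ≡⟨ cong (λ X → at X (opposite i) j) (sym B-rot) ⟩
  at (rot B) (opposite i) j        ≡⟨ at-rot B (opposite i) j ⟩
  at B j (opposite (opposite i))   ≡⟨ cong (at B j) (Fin.opposite-involutive i) ⟩
  at B j i                         ≡⟨ sym (at-transpose B i j) ⟩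
  at (transpose B) i j             ∎
  where open ≡-Reasoning

NonAttacking : ∀ {n} → Board n → Set
NonAttacking Q = ∀ p q → p ∈B Q → q ∈B Q → p ≢ q → ¬ Attack p q

attackers-equal : ∀ {n} {Q : Board n} {p q} → NonAttacking Q → p ∈B Q → q ∈B Q → Attack p q → p ≡ q
attackers-equal {p = p} {q} Q-safe p∈Q q∈Q p⚔q =
  decidable-stable (≡-dec Fin._≟_ Fin._≟_ p q) λ p≢q → Q-safe p q p∈Q q∈Q p≢q p⚔q

Attack-sym : ∀ {n} {p q : Cell n} → Attack p q → Attack q p
Attack-sym (inj₁ e)               = inj₁ (sym e)
Attack-sym (inj₂ (inj₁ e))        = inj₂ (inj₁ (sym e))
Attack-sym (inj₂ (inj₂ (inj₁ e))) = inj₂ (inj₂ (inj₁ (sym e)))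
Attack-sym (inj₂ (inj₂ (inj₂ e))) = inj₂ (inj₂ (inj₂ (sym e)))

Attack-transpose : ∀ {n} {a b c d : Fin n} → Attack (a , b) (c , d) → Attack (b , a) (d , c)
Attack-transpose (inj₁ e)        = inj₂ (inj₁ e)
Attack-transpose (inj₂ (inj₁ e)) = inj₁ e
Attack-transpose {a = a} {b} {c} {d} (inj₂ (inj₂ (inj₁ e))) =
  inj₂ (inj₂ (inj₁ (trans (+-comm (toℕ a) (toℕ d)) (trans (sym e) (+-comm (toℕ b) (toℕ c))))))
Attack-transpose {a = a} {b} {c} {d} (inj₂ (inj₂ (inj₂ e))) =
  inj₂ (inj₂ (inj₂ (trans (+-comm (toℕ b) (toℕ a)) (trans e (+-comm (toℕ c) (toℕ d))))))

opposite-+ : ∀ {n} (i : Fin n) → toℕ (opposite i) + suc (toℕ i) ≡ n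
opposite-+ i = trans (cong (_+ suc (toℕ i)) (Fin.opposite-prop i)) (m∸n+n≡m (Fin.toℕ<n i))

diagonal-half-turn : ∀ a b c d {c' d' N} → b + c ≡ d + a → c' + c ≡ N → d' + d ≡ N → a + c' ≡ d' + b
diagonal-half-turn a b c d {c'} {d'} b+c≡d+a c'+c≡N d'+d≡N = +-cancelʳ-≡ (c + d) _ _ (begin
  a + c' + (c + d)  ≡⟨ regroup₁ a c' c d ⟩
  c' + c + (a + d)  ≡⟨ cong₂ _+_ (trans c'+c≡N (sym d'+d≡N)) (+-comm a d) ⟩
  d' + d + (d + a)  ≡⟨ cong (d' + d +_) (sym b+c≡d+a) ⟩
  d' + d + (b + c)  ≡⟨ regroup₂ d' d b c ⟩
  d' + b + (c + d)  ∎)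
  where
  open ≡-Reasoning
  regroup₁ : ∀ a c' c d → a + c' + (c + d) ≡ c' + c + (a + d)
  regroup₁ = solve-∀
  regroup₂ : ∀ d' d b c → d' + d + (b + c) ≡ d' + b + (c + d)
  regroup₂ = solve-∀

-- Transposing the row, column, diagonal or anti-diagonal through p gives the column, row,
-- diagonal or anti-diagonal through the rotation of p by three, one, two or zero quarter turns.
transpose-attacked : ∀ {n} {U : Board n} {a b : Fin n} {p} → rot U ≡ U → p ∈B U → Attack (a , b) p →
  ∃ λ q → q ∈B U × Attack (b , a) q
transpose-attacked {p = c , d} U-rot p∈U (inj₁ a≡c) =
  turn (turn (turn (c , d))) , ∈-turn U-rot (∈-turn U-rot (∈-turn U-rot p∈U)) ,
  inj₂ (inj₁ (trans a≡c (sym (Fin.opposite-involutive c))))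
transpose-attacked U-rot p∈U (inj₂ (inj₁ b≡d)) = _ , ∈-turn U-rot p∈U , inj₁ b≡d
transpose-attacked {a = a} {b} {c , d} U-rot p∈U (inj₂ (inj₂ (inj₁ e))) =
  turn (turn (c , d)) , ∈-turn U-rot (∈-turn U-rot p∈U) , inj₂ (inj₂ (inj₁
    (diagonal-half-turn (toℕ a) (toℕ b) (suc (toℕ c)) (suc (toℕ d))
      (trans (+-suc (toℕ b) (toℕ c)) (cong suc e)) (opposite-+ c) (opposite-+ d))))
transpose-attacked {a = a} {b} U-rot p∈U (inj₂ (inj₂ (inj₂ e))) =
  _ , p∈U , inj₂ (inj₂ (inj₂ (trans (+-comm (toℕ b) (toℕ a)) e)))

-- Counting queens

indicator : Bool → ℕ
indicator true  = 1
indicator false = 0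

indicator-∨ : ∀ x y → (x ≡ true → y ≡ true → ⊥) → indicator (x ∨ y) ≡ indicator x + indicator y
indicator-∨ true  true  x∧y = ⊥-elim (x∧y refl refl)
indicator-∨ true  false _   = refl
indicator-∨ false y     _   = refl

∣∣-∑ : ∀ {n} (v : Subset n) → ∣ v ∣ ≡ ∑[ j < n ] indicator (lookup v j)
∣∣-∑ []          = refl
∣∣-∑ (true ∷ v)  = cong suc (∣∣-∑ v)
∣∣-∑ (false ∷ v) = ∣∣-∑ v

card-∑ : ∀ {n} (B : Board n) → card B ≡ ∑[ i < n ] ∑[ j < n ] indicator (at B i j)
card-∑ = rows
  where
  rows : ∀ {m n} (B : Vec (Subset n) m) →
    Vec.sum (Vec.map ∣_∣ B) ≡ ∑[ i < m ] ∑[ j < n ] indicator (lookup (lookup B i) j)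
  rows []      = refl
  rows (v ∷ B) = cong₂ _+_ (∣∣-∑ v) (rows B)

card-∪ : ∀ {n} (A B : Board n) → Disjoint A B → card (A ∪B B) ≡ card A + card B
card-∪ {n} A B A#B = begin
  card (A ∪B B)
    ≡⟨ card-∑ (A ∪B B) ⟩
  ∑[ i < n ] ∑[ j < n ] indicator (at (A ∪B B) i j)
    ≡⟨ sum-cong-≗ (λ i → sum-cong-≗ λ j → trans (cong indicator (at-∪ A B i j))
         (indicator-∨ _ _ λ a b → A#B (i , j) (a , b))) ⟩
  ∑[ i < n ] ∑[ j < n ] (indicator (at A i j) + indicator (at B i j))
    ≡⟨ sum-cong-≗ (λ i → ∑-distrib-+ (λ j → indicator (at A i j)) (λ j → indicator (at B i j))) ⟩
  ∑[ i < n ] (∑[ j < n ] indicator (at A i j) + ∑[ j < n ] indicator (at B i j))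
    ≡⟨ ∑-distrib-+ (λ i → ∑[ j < n ] indicator (at A i j)) (λ i → ∑[ j < n ] indicator (at B i j)) ⟩
  ∑[ i < n ] ∑[ j < n ] indicator (at A i j) + ∑[ i < n ] ∑[ j < n ] indicator (at B i j)
    ≡⟨ sym (cong₂ _+_ (card-∑ A) (card-∑ B)) ⟩
  card A + card B ∎
  where open ≡-Reasoning

card-transpose : ∀ {n} (B : Board n) → card (transpose B) ≡ card B
card-transpose {n} B = begin
  card (transpose B)
    ≡⟨ card-∑ (transpose B) ⟩
  ∑[ i < n ] ∑[ j < n ] indicator (at (transpose B) i j)
    ≡⟨ sum-cong-≗ (λ i → sum-cong-≗ λ j → cong indicator (at-transpose B i j)) ⟩
  ∑[ i < n ] ∑[ j < n ] indicator (at B j i)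
    ≡⟨ ∑-comm (λ i j → indicator (at B j i)) ⟩
  ∑[ j < n ] ∑[ i < n ] indicator (at B j i)
    ≡⟨ sym (card-∑ B) ⟩
  card B ∎
  where open ≡-Reasoning

∑-indicator-≤1 : ∀ {n} (v : Fin n → Bool) → (∀ {j j'} → v j ≡ true → v j' ≡ true → j ≡ j') →
  ∑[ j < n ] indicator (v j) ≤ 1
∑-indicator-≤1 {zero}  v v-unique = z≤n
∑-indicator-≤1 {suc n} v v-unique with v fzero in v₀
... | true  = ≤-reflexive (cong suc (trans (sum-cong-≗ others-empty) (sum-replicate-zero n)))
  where
  others-empty : ∀ j → indicator (v (fsuc j)) ≡ 0
  others-empty j with v (fsuc j) in vⱼ
  ... | true  = case v-unique v₀ vⱼ of λ ()
  ... | false = refl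
... | false = ∑-indicator-≤1 (v ∘ fsuc) λ vj vj' → Fin.suc-injective (v-unique vj vj')

∑-indicator-pos : ∀ {n} (v : Fin n → Bool) → 1 ≤ ∑[ j < n ] indicator (v j) → ∃ λ j → v j ≡ true
∑-indicator-pos {suc n} v pos with v fzero in v₀
... | true  = fzero , v₀
... | false = let (j , vj) = ∑-indicator-pos (v ∘ fsuc) pos in fsuc j , vj

∑-≤ : ∀ {n} (f : Fin n → ℕ) → (∀ i → f i ≤ 1) → ∑[ i < n ] f i ≤ n
∑-≤ {zero}  f f≤1 = z≤n
∑-≤ {suc n} f f≤1 = +-mono-≤ (f≤1 fzero) (∑-≤ (f ∘ fsuc) (f≤1 ∘ fsuc))

∑-saturated : ∀ {n} (f : Fin n → ℕ) → (∀ i → f i ≤ 1) → ∑[ i < n ] f i ≡ n → ∀ i → 1 ≤ f i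
∑-saturated {suc n} f f≤1 ∑f≡n i = +-cancelʳ-≤ n 1 (f i) (begin
  suc n                    ≡⟨ sym ∑f≡n ⟩
  sum f                    ≡⟨ sum-remove f ⟩
  f i + sum (removeAt f i) ≤⟨ +-monoʳ-≤ (f i) (∑-≤ (removeAt f i) (f≤1 ∘ punchIn i)) ⟩
  f i + n                  ∎)
  where open ≤-Reasoning

queens-row-occupied : ∀ {n} {Q : Board n} → IsQueens n Q → ∀ i → ∃ λ j → (i , j) ∈B Q
queens-row-occupied {n} {Q} (card≡n , Q-safe) i =
  ∑-indicator-pos (at Q i) (∑-saturated row-count row-count≤1 (trans (sym (card-∑ Q)) card≡n) i)
  where
  row-count : Fin n → ℕ
  row-count i = ∑[ j < n ] indicator (at Q i j)
  row-count≤1 : ∀ i → row-count i ≤ 1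
  row-count≤1 i = ∑-indicator-≤1 (at Q i) λ ij∈Q ij'∈Q →
    cong proj₂ (attackers-equal {Q = Q} Q-safe ij∈Q ij'∈Q (inj₁ refl))

-- Transposing a rotation-symmetric completion

SymmetricCompletion : ∀ {n} → Board n → Board n → Set
SymmetricCompletion {n} U D = Disjoint D U × IsQueens n (D ∪B U) × rot (D ∪B U) ≡ D ∪B U

module _ {n} {U D : Board n} (U-rot : rot U ≡ U) (D-completes : SymmetricCompletion U D) where

  private
    Q : Board n
    Q = D ∪B U
    D→Q : ∀ {p} → p ∈B D → p ∈B Q
    D→Q = ∈-∪⁺ˡ D U
    U→Q : ∀ {p} → p ∈B U → p ∈B Q
    U→Q = ∈-∪⁺ʳ D U
    D#U : Disjoint D U
    D#U = proj₁ D-completes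
    card≡n : card Q ≡ n
    card≡n = proj₁ (proj₁ (proj₂ D-completes))
    Q-safe : NonAttacking Q
    Q-safe = proj₂ (proj₁ (proj₂ D-completes))
    Q-rot : rot Q ≡ Q
    Q-rot = proj₂ (proj₂ D-completes)

    D-rot : rot D ≡ D
    D-rot = ∪-cancelʳ (disjoint-rot D U-rot D#U) D#U (begin
      rot D ∪B U      ≡⟨ cong (rot D ∪B_) (sym U-rot) ⟩
      rot D ∪B rot U  ≡⟨ sym (rot-∪ D U) ⟩
      rot (D ∪B U)    ≡⟨ Q-rot ⟩
      D ∪B U          ∎)
      where open ≡-Reasoning

    D-safe-from-U : ∀ {p q} → p ∈B D → q ∈B U → ¬ Attack p q
    D-safe-from-U p∈D q∈U p⚔q with attackers-equal {Q = Q} Q-safe (D→Q p∈D) (U→Q q∈U) p⚔q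
    ... | refl = D#U _ (p∈D , q∈U)

    transpose-safe-from-U : ∀ {p q} → p ∈B transpose D → q ∈B U → ¬ Attack p q
    transpose-safe-from-U p∈Dᵀ q∈U p⚔q =
      let (q' , q'∈U , p⚔q') = transpose-attacked U-rot q∈U p⚔q
      in D-safe-from-U (∈-transpose D p∈Dᵀ) q'∈U p⚔q'

    transpose-disjoint : Disjoint (transpose D) U
    transpose-disjoint p (p∈Dᵀ , p∈U) = transpose-safe-from-U p∈Dᵀ p∈U (inj₁ refl)

    transpose-safe : NonAttacking (transpose D ∪B U)
    transpose-safe (a , b) (c , d) p∈Qᵀ q∈Qᵀ p≢q p⚔q
      with ∈-∪⁻ (transpose D) U p∈Qᵀ | ∈-∪⁻ (transpose D) U q∈Qᵀ
    ... | inj₁ p∈Dᵀ | inj₁ q∈Dᵀ = Q-safe (b , a) (d , c) (D→Q (∈-transpose D p∈Dᵀ)) (D→Q (∈-transpose D q∈Dᵀ))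
                                    (p≢q ∘ cong swap) (Attack-transpose p⚔q)
    ... | inj₂ p∈U  | inj₂ q∈U  = Q-safe (a , b) (c , d) (U→Q p∈U) (U→Q q∈U) p≢q p⚔q
    ... | inj₁ p∈Dᵀ | inj₂ q∈U  = transpose-safe-from-U p∈Dᵀ q∈U p⚔q
    ... | inj₂ p∈U  | inj₁ q∈Dᵀ = transpose-safe-from-U q∈Dᵀ p∈U (Attack-sym p⚔q)

    transpose-card : card (transpose D ∪B U) ≡ n
    transpose-card = begin
      card (transpose D ∪B U)       ≡⟨ card-∪ (transpose D) U transpose-disjoint ⟩
      card (transpose D) + card U   ≡⟨ cong (_+ card U) (card-transpose D) ⟩
      card D + card U               ≡⟨ sym (card-∪ D U D#U) ⟩
      card Q                        ≡⟨ card≡n ⟩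
      n                             ∎
      where open ≡-Reasoning

  transpose-completion : SymmetricCompletion U (transpose D)
  transpose-completion = transpose-disjoint , (transpose-card , transpose-safe) ,
    trans (rot-∪ (transpose D) U) (cong₂ _∪B_ (rot-transpose D-rot) U-rot)

  -- (a, b) and (b, a) share an anti-diagonal; (a, a) and its rotation (a, opposite a) share a row.
  transpose-fixed-completion-central : transpose D ≡ D → ∀ {a b} → (a , b) ∈B D → opposite a ≡ a
  transpose-fixed-completion-central D-sym {a} {b} ab∈D =
    sym (cong proj₂ (same-cell aa∈D (∈-turn D-rot aa∈D) (inj₁ refl)))
    where
    same-cell : ∀ {p q} → p ∈B D → q ∈B D → Attack p q → p ≡ q
    same-cell p∈D q∈D = attackers-equal {Q = Q} Q-safe (D→Q p∈D) (D→Q q∈D)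
    ba∈D : (b , a) ∈B D
    ba∈D = ∈-transpose D (subst (λ X → (a , b) ∈B X) (sym D-sym) ab∈D)
    a≡b : a ≡ b
    a≡b = cong proj₁ (same-cell ab∈D ba∈D (inj₂ (inj₂ (inj₂ (+-comm (toℕ a) (toℕ b))))))
    aa∈D : (a , a) ∈B D
    aa∈D = subst (λ x → (a , x) ∈B D) (sym a≡b) ab∈D

-- Finite enumeration and pairing

∈-─⁻ : ∀ {A : Set} {v y : A} xs (v∈xs : v ∈ xs) → y ∈ xs ─ v∈xs → y ∈ xs
∈-─⁻ (x ∷ xs) (here _)   y∈         = there y∈
∈-─⁻ (x ∷ xs) (there v∈) (here y≡x) = here y≡x
∈-─⁻ (x ∷ xs) (there v∈) (there y∈) = there (∈-─⁻ xs v∈ y∈)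

∈-─⁺ : ∀ {A : Set} {v y : A} xs (v∈xs : v ∈ xs) → y ∈ xs → y ≢ v → y ∈ xs ─ v∈xs
∈-─⁺ (x ∷ xs) (here refl) (here refl) y≢v = ⊥-elim (y≢v refl)
∈-─⁺ (x ∷ xs) (here _)    (there y∈)  _   = y∈
∈-─⁺ (x ∷ xs) (there v∈)  (here y≡x)  _   = here y≡x
∈-─⁺ (x ∷ xs) (there v∈)  (there y∈)  y≢v = there (∈-─⁺ xs v∈ y∈ y≢v)

∉-─ : ∀ {A : Set} {v : A} {xs} (v∈xs : v ∈ xs) → Unique xs → v ∉ xs ─ v∈xs
∉-─ (here refl) (x∉xs ∷ _) v∈          = All.lookup x∉xs v∈ refl
∉-─ (there v∈)  (x∉xs ∷ _) (here v≡x)  = All.lookup x∉xs v∈ (sym v≡x)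
∉-─ (there v∈)  (_ ∷ xs!)  (there v∈') = ∉-─ v∈ xs! v∈'

unique-─ : ∀ {A : Set} {v : A} {xs} (v∈xs : v ∈ xs) → Unique xs → Unique (xs ─ v∈xs)
unique-─ (here _)   (_ ∷ xs!)    = xs!
unique-─ (there v∈) (x∉xs ∷ xs!) = All.─⁺ v∈ x∉xs ∷ unique-─ v∈ xs!

module _ {A : Set} (f : A → A) (f-involutive : ∀ x → f (f x) ≡ x) where

  private
    f-injective : ∀ {x y} → f x ≡ f y → x ≡ y
    f-injective {x} {y} fx≡fy = trans (sym (f-involutive x)) (trans (cong f fx≡fy) (f-involutive y))

    paired : ∀ k xs → length xs ≤ k → Unique xs →
      (∀ {x} → x ∈ xs → f x ∈ xs) → (∀ {x} → x ∈ xs → f x ≢ x) → 2 ∣ length xs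
    paired _       []       _          _            _      _     = 2 ∣0
    paired (suc k) (x ∷ xs) (s≤s len≤k) (x∉xs ∷ xs!) closed moved =
      subst (λ m → 2 ∣ suc m) (sym xs-len) (∣m∣n⇒∣m+n ∣-refl
        (paired k rest rest-len rest! rest-closed (moved ∘ there ∘ ∈-─⁻ xs fx∈xs)))
      where
      fx∈xs : f x ∈ xs
      fx∈xs with closed (here refl)
      ... | here fx≡x = ⊥-elim (moved (here refl) fx≡x)
      ... | there fx∈ = fx∈
      rest : List A
      rest = xs ─ fx∈xs
      xs-len : length xs ≡ suc (length rest)
      xs-len = length-removeAt′ xs (index fx∈xs)
      rest-len : length rest ≤ k
      rest-len = ≤-trans (n≤1+n _) (subst (_≤ k) xs-len len≤k)
      rest! : Unique rest
      rest! = unique-─ fx∈xs xs!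
      rest-closed : ∀ {y} → y ∈ rest → f y ∈ rest
      rest-closed {y} y∈rest with closed (there (∈-─⁻ xs fx∈xs y∈rest))
      ... | here fy≡x =
        ⊥-elim (∉-─ fx∈xs xs! (subst (_∈ rest) (trans (sym (f-involutive y)) (cong f fy≡x)) y∈rest))
      ... | there fy∈xs = ∈-─⁺ xs fx∈xs fy∈xs λ fy≡fx →
        All.lookup x∉xs (∈-─⁻ xs fx∈xs y∈rest) (sym (f-injective fy≡fx))

  involution-even-length : ∀ {xs} → Unique xs →
    (∀ {x} → x ∈ xs → f x ∈ xs) → (∀ {x} → x ∈ xs → f x ≢ x) → 2 ∣ length xs
  involution-even-length {xs} = paired (length xs) xs ≤-refl

vectors : ∀ {A : Set} n → List A → List (Vec A n)
vectors zero    xs = [] ∷ []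
vectors (suc n) xs = cartesianProductWith _∷_ xs (vectors n xs)

∈-vectors : ∀ {A : Set} {xs : List A} n → (∀ x → x ∈ xs) → ∀ v → v ∈ vectors n xs
∈-vectors zero    xs-full []      = here refl
∈-vectors (suc n) xs-full (x ∷ v) = ∈-cartesianProductWith⁺ _∷_ (xs-full x) (∈-vectors n xs-full v)

boards : ∀ n → List (Board n)
boards n = vectors n (vectors n (true ∷ false ∷ []))

∈-boards : ∀ {n} (B : Board n) → B ∈ boards n
∈-boards {n} = ∈-vectors n (∈-vectors n λ { true → here refl ; false → there (here refl) })

_≟-board_ : ∀ {n} → DecidableEquality (Board n)
_≟-board_ = Vec.≡-dec (Vec.≡-dec Bool._≟_)

enumerate : ∀ {n} {P : Board n → Set} → Decidable P → ∃ λ xs → Unique xs × (∀ B → B ∈ xs ⇔ P B)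
enumerate {n} P? = deduplicate _≟-board_ candidates , deduplicate-! _≟-board_ candidates , λ B → mk⇔
  (λ B∈xs → proj₂ (∈-filter⁻ P? {xs = boards n} (∈-deduplicate⁻ _≟-board_ candidates B∈xs)))
  (λ PB → ∈-deduplicate⁺ _≟-board_ (∈-filter⁺ P? (∈-boards B) PB))
  where
  candidates = filter P? (boards n)

even-card : ∀ {n} {P : Board n → Set} → Decidable P → (f : Board n → Board n) → (∀ B → f (f B) ≡ B) →
  (∀ {B} → P B → P (f B)) → (∀ {B} → P B → f B ≢ B) → EvenCard P
even-card P? f f-involutive f-preserves f-moves with enumerate P?
... | xs , xs! , xs≡P = xs , xs! , xs≡P , involution-even-length f f-involutive xs!
  (λ {B} B∈xs → from (xs≡P (f B)) (f-preserves (to (xs≡P B) B∈xs)))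
  (λ {B} B∈xs → f-moves (to (xs≡P B) B∈xs))
  where open Equivalence

all-cells? : ∀ {n} {P : Cell n → Set} → (∀ p → Dec (P p)) → Dec (∀ p → P p)
all-cells? P? = map′ (λ P-all (i , j) → P-all i j) (λ P-all i j → P-all (i , j))
  (Fin.all? λ i → Fin.all? λ j → P? (i , j))

_∈B?_ : ∀ {n} (p : Cell n) (B : Board n) → Dec (p ∈B B)
(i , j) ∈B? B = at B i j Bool.≟ true

attack? : ∀ {n} (p q : Cell n) → Dec (Attack p q)
attack? (i , j) (i' , j') =
  i Fin.≟ i' ⊎-dec j Fin.≟ j' ⊎-dec (toℕ j + toℕ i' ≟ toℕ j' + toℕ i) ⊎-dec (toℕ i + toℕ j ≟ toℕ i' + toℕ j')

symmetric-completion? : ∀ {n} (U : Board n) → Decidable (SymmetricCompletion U)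
symmetric-completion? {n} U D =
  all-cells? (λ p → ¬? (p ∈B? D ×-dec p ∈B? U)) ×-dec
  ((card Q ≟ n) ×-dec all-cells? λ p → all-cells? λ q →
    p ∈B? Q →-dec q ∈B? Q →-dec ¬? (≡-dec Fin._≟_ Fin._≟_ p q) →-dec ¬? (attack? p q)) ×-dec
  (rot Q ≟-board Q)
  where
  Q = D ∪B U

-- The set U_ℓ

≡ᵇ-mirror : ∀ {a a' b b' N} → a + a' ≡ N → b + b' ≡ N → (a ≡ᵇ b) ≡ (a' ≡ᵇ b')
≡ᵇ-mirror {a} {a'} {b} {b'} a+a'≡N b+b'≡N = does-⇔ (mk⇔ to from) (a ≟ b) (a' ≟ b')
  where
  to : a ≡ b → a' ≡ b'
  to refl = +-cancelˡ-≡ a a' b' (trans a+a'≡N (sym b+b'≡N))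
  from : a' ≡ b' → a ≡ b
  from refl = +-cancelʳ-≡ a' a b (trans a+a'≡N (sym b+b'≡N))

≡ᵇ-true⇒≡ : ∀ {m k} → (m ≡ᵇ k) ≡ true → m ≡ k
≡ᵇ-true⇒≡ {m} {k} m≡ᵇk = ≡ᵇ⇒≡ m k (subst T (sym m≡ᵇk) _)

≢⇒≡ᵇ-false : ∀ {m k} → m ≢ k → (m ≡ᵇ k) ≡ false
≢⇒≡ᵇ-false {m} {k} = dec-false (m ≟ k)

centre-double : ∀ n → n % 4 ≡ 1 → (n + 1) / 2 + (n + 1) / 2 ≡ suc n
centre-double n n%4≡1 = begin
  (n + 1) / 2 + (n + 1) / 2  ≡⟨ cong (λ m → m + m) half≡1+2q ⟩
  (1 + q * 2) + (1 + q * 2)  ≡⟨ twice q ⟩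
  suc (1 + q * 4)            ≡⟨ cong suc (sym n≡1+4q) ⟩
  suc n                      ∎
  where
  open ≡-Reasoning
  q = n / 4
  n≡1+4q : n ≡ 1 + q * 4
  n≡1+4q = trans (m≡m%n+[m/n]*n n 4) (cong (_+ q * 4) n%4≡1)
  double : ∀ q → 1 + q * 4 + 1 ≡ (1 + q * 2) * 2
  double = solve-∀
  twice : ∀ q → (1 + q * 2) + (1 + q * 2) ≡ suc (1 + q * 4)
  twice = solve-∀
  half≡1+2q : (n + 1) / 2 ≡ 1 + q * 2
  half≡1+2q = begin
    (n + 1) / 2            ≡⟨ cong (λ m → (m + 1) / 2) n≡1+4q ⟩
    (1 + q * 4 + 1) / 2    ≡⟨ cong (_/ 2) (double q) ⟩
    (1 + q * 2) * 2 / 2    ≡⟨ m*n/n≡m (1 + q * 2) 2 ⟩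
    1 + q * 2              ∎

∨-rotate : ∀ a b c d e → d ∨ a ∨ b ∨ c ∨ e ≡ a ∨ b ∨ c ∨ d ∨ e
∨-rotate true  b     c     d e = ∨-zeroʳ d
∨-rotate false true  c     d e = ∨-zeroʳ d
∨-rotate false false true  d e = ∨-zeroʳ d
∨-rotate false false false d e = refl

-- Under the rotation (A, B) ↦ (B, n+1-A) the four corner terms of inU are permuted cyclically
-- and the centre term is fixed.
inU-rotate : ∀ {n ℓ} A A' B → ℓ ≤ suc n → A' + A ≡ suc n → inU n ℓ B A' ≡ inU n ℓ A B
inU-rotate {n} {ℓ} A A' B ℓ≤1+n A'+A≡1+n = begin
  inU n ℓ B A'
    ≡⟨⟩
  (B ≡ᵇ 1) ∧ (A' ≡ᵇ ℓ) ∨ (B ≡ᵇ ℓ) ∧ (A' ≡ᵇ n) ∨ (B ≡ᵇ n) ∧ (A' ≡ᵇ ℓ') ∨ (B ≡ᵇ ℓ') ∧ (A' ≡ᵇ 1) ∨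
    centred (B ≡ᵇ c) (A' ≡ᵇ c)
    ≡⟨ cong₂ _∨_ (swap-mirrored (mirror ℓ ℓ' ℓ+ℓ'≡1+n))
      (cong₂ _∨_ (swap-mirrored (mirror n 1 (+-comm n 1)))
      (cong₂ _∨_ (swap-mirrored (mirror ℓ' ℓ (trans (+-comm ℓ' ℓ) ℓ+ℓ'≡1+n)))
      (cong₂ _∨_ (swap-mirrored (mirror 1 n refl))
      centre))) ⟩
  t₄ ∨ t₁ ∨ t₂ ∨ t₃ ∨ t₅
    ≡⟨ ∨-rotate t₁ t₂ t₃ t₄ t₅ ⟩
  inU n ℓ A B
    ∎
  where
  open ≡-Reasoning
  ℓ' = suc n ∸ ℓ
  c = (n + 1) / 2
  centred : Bool → Bool → Bool
  centred x y = (n % 4 ≡ᵇ 1) ∧ x ∧ y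
  t₁ t₂ t₃ t₄ t₅ : Bool
  t₁ = (A ≡ᵇ 1) ∧ (B ≡ᵇ ℓ)
  t₂ = (A ≡ᵇ ℓ) ∧ (B ≡ᵇ n)
  t₃ = (A ≡ᵇ n) ∧ (B ≡ᵇ ℓ')
  t₄ = (A ≡ᵇ ℓ') ∧ (B ≡ᵇ 1)
  t₅ = centred (A ≡ᵇ c) (B ≡ᵇ c)
  ℓ+ℓ'≡1+n : ℓ + ℓ' ≡ suc n
  ℓ+ℓ'≡1+n = m+[n∸m]≡n ℓ≤1+n
  mirror : ∀ b b' → b + b' ≡ suc n → (A' ≡ᵇ b) ≡ (A ≡ᵇ b')
  mirror b b' = ≡ᵇ-mirror {A'} {A} {b} {b'} A'+A≡1+n
  swap-mirrored : ∀ {x y z} → y ≡ z → x ∧ y ≡ z ∧ x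
  swap-mirrored {x} y≡z = trans (cong (x ∧_) y≡z) (∧-comm x _)
  centre : centred (B ≡ᵇ c) (A' ≡ᵇ c) ≡ centred (A ≡ᵇ c) (B ≡ᵇ c)
  centre with n % 4 ≡ᵇ 1 in n%4≡ᵇ1
  ... | false = refl
  ... | true  = swap-mirrored (mirror c c (centre-double n (≡ᵇ-true⇒≡ n%4≡ᵇ1)))

at-U : ∀ {n} ℓ (i j : Fin n) → at (U n ℓ) i j ≡ inU n ℓ (suc (toℕ i)) (suc (toℕ j))
at-U {n} ℓ = at-tabulate λ i j → inU n ℓ (suc (toℕ i)) (suc (toℕ j))

U-rot : ∀ {n ℓ} → ℓ ≤ suc n → rot (U n ℓ) ≡ U n ℓ
U-rot {n} {ℓ} ℓ≤1+n = board-ext λ i j → begin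
  at (rot (U n ℓ)) i j                              ≡⟨ at-rot (U n ℓ) i j ⟩
  at (U n ℓ) j (opposite i)                         ≡⟨ at-U ℓ j (opposite i) ⟩
  inU n ℓ (suc (toℕ j)) (suc (toℕ (opposite i)))    ≡⟨ inU-rotate (suc (toℕ i)) (suc (toℕ (opposite i)))
                                                         (suc (toℕ j)) ℓ≤1+n (cong suc (opposite-+ i)) ⟩
  inU n ℓ (suc (toℕ i)) (suc (toℕ j))               ≡⟨ sym (at-U ℓ i j) ⟩
  at (U n ℓ) i j                                    ∎
  where open ≡-Reasoning

inU-free-row : ∀ {n ℓ R} B → R ≢ 1 → R ≢ ℓ → R ≢ n → R ≢ suc n ∸ ℓ → R + R ≢ suc n → inU n ℓ R B ≡ false
inU-free-row {n} {ℓ} {R} B R≢1 R≢ℓ R≢n R≢ℓ' R+R≢1+n =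
  cong₂ _∨_ (absent (B ≡ᵇ ℓ) R≢1)
  (cong₂ _∨_ (absent (B ≡ᵇ n) R≢ℓ)
  (cong₂ _∨_ (absent (B ≡ᵇ suc n ∸ ℓ) R≢n)
  (cong₂ _∨_ (absent (B ≡ᵇ 1) R≢ℓ')
  off-centre)))
  where
  c = (n + 1) / 2
  absent : ∀ {k} x → R ≢ k → (R ≡ᵇ k) ∧ x ≡ false
  absent x R≢k = cong (_∧ x) (≢⇒≡ᵇ-false R≢k)
  off-centre : (n % 4 ≡ᵇ 1) ∧ (R ≡ᵇ c) ∧ (B ≡ᵇ c) ≡ false
  off-centre with n % 4 ≡ᵇ 1 in n%4≡ᵇ1
  ... | false = refl
  ... | true  = absent (B ≡ᵇ c) λ R≡c →
    R+R≢1+n (trans (cong₂ _+_ R≡c R≡c) (centre-double n (≡ᵇ-true⇒≡ n%4≡ᵇ1)))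

row-2-or-3-avoiding : ∀ ℓ ℓ' → ℓ + ℓ' ≢ 5 → ∃ λ R → 2 ≤ R × R ≤ 3 × R ≢ ℓ × R ≢ ℓ'
row-2-or-3-avoiding ℓ ℓ' ℓ+ℓ'≢5 with ℓ ≟ 2 | ℓ' ≟ 2
... | yes refl | _        = 3 , n≤1+n 2 , ≤-refl , (λ ()) , λ 3≡ℓ' → ℓ+ℓ'≢5 (cong (2 +_) (sym 3≡ℓ'))
... | no _     | yes refl = 3 , n≤1+n 2 , ≤-refl , (λ 3≡ℓ → ℓ+ℓ'≢5 (cong (_+ 2) (sym 3≡ℓ))) , λ ()
... | no ℓ≢2   | no ℓ'≢2  = 2 , ≤-refl , n≤1+n 2 , ℓ≢2 ∘ sym , ℓ'≢2 ∘ sym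

U-free-row : ∀ {n ℓ} → 6 ≤ n → ℓ ≤ suc n → ∃ λ (r : Fin n) → toℕ r ≤ 2 × ∀ j → ¬ (r , j) ∈B U n ℓ
U-free-row {n} {ℓ} 6≤n ℓ≤1+n
  with row-2-or-3-avoiding ℓ (suc n ∸ ℓ) (λ ℓ+ℓ'≡5 →
         <⇒≢ (m≤n⇒m≤1+n 6≤n) (trans (sym ℓ+ℓ'≡5) (m+[n∸m]≡n ℓ≤1+n)))
... | suc r , 2≤R , R≤3 , R≢ℓ , R≢ℓ' =
  fromℕ< r<n , subst (_≤ 2) (sym (Fin.toℕ-fromℕ< r<n)) (≤-pred R≤3) ,
  λ j rj∈U → case trans (sym (free j)) rj∈U of λ ()
  where
  R<n : suc r < n
  R<n = ≤-trans (s≤s R≤3) (≤-trans (m≤m+n 4 2) 6≤n)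
  r<n : r < n
  r<n = <⇒≤ R<n
  free : ∀ j → at (U n ℓ) (fromℕ< r<n) j ≡ false
  free j = begin
    at (U n ℓ) (fromℕ< r<n) j                      ≡⟨ at-U ℓ (fromℕ< r<n) j ⟩
    inU n ℓ (suc (toℕ (fromℕ< r<n))) (suc (toℕ j)) ≡⟨ cong (λ x → inU n ℓ (suc x) (suc (toℕ j)))
                                                          (Fin.toℕ-fromℕ< r<n) ⟩
    inU n ℓ (suc r) (suc (toℕ j))                  ≡⟨ inU-free-row (suc (toℕ j)) (>⇒≢ 2≤R) R≢ℓ (<⇒≢ R<n) R≢ℓ'
                                                        (<⇒≢ (s≤s (≤-trans (+-mono-≤ R≤3 R≤3) 6≤n))) ⟩
    false                                          ∎
    where open ≡-Reasoning

no-transpose-fixed-completion : ∀ {n ℓ} {D : Board n} → 6 ≤ n → ℓ ≤ suc n →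
  SymmetricCompletion (U n ℓ) D → transpose D ≢ D
no-transpose-fixed-completion {n} {ℓ} {D} 6≤n ℓ≤1+n D-completes D-sym
  with U-free-row 6≤n ℓ≤1+n
... | r , r≤2 , r-free with queens-row-occupied {Q = D ∪B U n ℓ} (proj₁ (proj₂ D-completes)) r
... | j , rj∈Q with ∈-∪⁻ D (U n ℓ) rj∈Q
... | inj₂ rj∈U = r-free j rj∈U
... | inj₁ rj∈D = ≤⇒≯ n≤5 6≤n
  where
  r-central : opposite r ≡ r
  r-central = transpose-fixed-completion-central (U-rot ℓ≤1+n) D-completes D-sym rj∈D
  n≤5 : n ≤ 5
  n≤5 = subst (_≤ 5) (subst (λ i → toℕ i + suc (toℕ r) ≡ n) r-central (opposite-+ r))
          (+-mono-≤ r≤2 (s≤s r≤2))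

lemma6 : (n ℓ : ℕ) → 6 ≤ n → (n % 4 ≡ 0 ⊎ n % 4 ≡ 1) → 1 ≤ ℓ → ℓ ≤ n →
    EvenCard (InDℓ n ℓ)
lemma6 n ℓ 6≤n _ _ ℓ≤n =
  even-card (symmetric-completion? (U n ℓ)) transpose transpose-involutive
    (transpose-completion (U-rot ℓ≤1+n)) (no-transpose-fixed-completion 6≤n ℓ≤1+n)
  where
  ℓ≤1+n : ℓ ≤ suc n
  ℓ≤1+n = m≤n⇒m≤1+n ℓ≤n
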